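{- Let $a,b,m,N$ be positive integers with $m\ge 3$ and $N=\frac m2(a-b)+b\ge \frac35 m$. Suppose that $b$ belongs to the interval $\left[\frac32+\sqrt{\frac{10N}{m}-3},\ 1+\sqrt{\frac{12N}{m}}\right]$. Then $b^2<6a$ and $5a<b^2+2b+6$. -}

module Defs where

open import Data.Nat using (ℕ)
open import Data.Integer using (ℤ; +_; _+_; _-_; _*_; _≤_)
open import Data.Product using (_×_)

-- Real square roots are unavailable; for a real x ≥ 0 and real y,
--   √x ≤ y   ⟺   0 ≤ y  ∧  x ≤ y²
-- We use this with the fractions cleared (all quantities are integers).

-- "3/2 + √(10N/m − 3) ≤ b", i.e. √(10N/m − 3) ≤ (2b−3)/2,
-- multiplied through by 4m > 0:  0 ≤ 2b − 3  and  4(10N − 3m) ≤ m(2b − 3)².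
LowerEnd : ℕ → ℕ → ℕ → Set
LowerEnd m N b =
  (+ 0 ≤ + 2 * + b - + 3) ×
  (+ 4 * (+ 10 * + N - + 3 * + m) ≤ + m * ((+ 2 * + b - + 3) * (+ 2 * + b - + 3)))

-- "b ≤ 1 + √(12N/m)", i.e. b − 1 ≤ √(12N/m).  Since b ≥ 1 here, b − 1 ≥ 0,
-- and this is (b − 1)² ≤ 12N/m, i.e. m(b − 1)² ≤ 12N.
UpperEnd : ℕ → ℕ → ℕ → Set
UpperEnd m N b = + m * ((+ b - + 1) * (+ b - + 1)) ≤ + 12 * + N

-- Substituting 2N = m(a − b) + 2b into the two squared end-point inequalities turns them into
--   m·b² + (m + 4(m − 3)b) ≤ m·6a   and   4m·5a + (3m + 40b) ≤ 4m(b² + 2b + 6),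
-- whose bracketed slack terms are positive; cancelling m and 4m gives the claims.
module Submission where

open import Defs
open import Data.Nat using (ℕ; _<_; _≤_; _+_; _*_)
open import Data.Integer using (ℤ; +_) renaming (_+_ to _+ℤ_; _-_ to _-ℤ_; _*_ to _*ℤ_)
open import Relation.Binary.PropositionalEquality using (_≡_)
open import Data.Product using (_×_)

open import Data.Nat using (z≤n; s≤s)
open import Data.Integer using (0ℤ; +≤+; +<+; nonNegative)
  renaming (_≤_ to _≤ℤ_; _<_ to _<ℤ_)
open import Data.Integer.Properties
open import Data.Integer.Tactic.RingSolver using (solve)
open import Data.List using ([]; _∷_)
open import Data.Product using (_,_)
open import Relation.Binary.PropositionalEquality using (sym; cong; subst; subst₂; cong₂)

i<i+j : ∀ i {j} → 0ℤ <ℤ j → i <ℤ i +ℤ j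
i<i+j i 0<j = subst (_<ℤ i +ℤ _) (+-identityʳ i) (+-monoʳ-< i 0<j)

module _ {a b m N : ℤ} (2N≡ : + 2 *ℤ N ≡ m *ℤ (a -ℤ b) +ℤ + 2 *ℤ b) where

  upperEnd⇒b²<6a : 0ℤ ≤ℤ b → + 3 ≤ℤ m →
                   m *ℤ ((b -ℤ + 1) *ℤ (b -ℤ + 1)) ≤ℤ + 12 *ℤ N → b *ℤ b <ℤ + 6 *ℤ a
  upperEnd⇒b²<6a 0≤b 3≤m upper =
    *-cancelˡ-<-nonNeg m ⦃ nonNegative 0≤m ⦄ (begin-strict
      m *ℤ (b *ℤ b)                                     <⟨ i<i+j _ slack-pos ⟩
      m *ℤ (b *ℤ b) +ℤ (m +ℤ (m -ℤ + 3) *ℤ (+ 4 *ℤ b))     ≡⟨ solve (b ∷ m ∷ []) ⟩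
      m *ℤ ((b -ℤ + 1) *ℤ (b -ℤ + 1)) +ℤ + 6 *ℤ (m -ℤ + 2) *ℤ b
                                                          ≤⟨ +-monoˡ-≤ _ upper ⟩
      + 12 *ℤ N +ℤ + 6 *ℤ (m -ℤ + 2) *ℤ b                 ≡⟨ solve (b ∷ m ∷ N ∷ []) ⟩
      + 6 *ℤ (+ 2 *ℤ N +ℤ (m -ℤ + 2) *ℤ b)                ≡⟨ cong (λ x → + 6 *ℤ (x +ℤ (m -ℤ + 2) *ℤ b)) 2N≡ ⟩
      + 6 *ℤ (m *ℤ (a -ℤ b) +ℤ + 2 *ℤ b +ℤ (m -ℤ + 2) *ℤ b) ≡⟨ solve (a ∷ b ∷ m ∷ []) ⟩
      m *ℤ (+ 6 *ℤ a)                                     ∎)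
    where
    open ≤-Reasoning
    0≤m : 0ℤ ≤ℤ m
    0≤m = ≤-trans (+≤+ z≤n) 3≤m
    slack-pos : 0ℤ <ℤ m +ℤ (m -ℤ + 3) *ℤ (+ 4 *ℤ b)
    slack-pos = +-mono-<-≤ (<-≤-trans (+<+ (s≤s z≤n)) 3≤m)
                  (*-monoʳ-≤-nonNeg (+ 4 *ℤ b) ⦃ nonNegative (*-monoˡ-≤-nonNeg (+ 4) 0≤b) ⦄ (i≤j⇒0≤j-i 3≤m))

  lowerEnd⇒5a<b²+2b+6 : 0ℤ ≤ℤ b → 0ℤ <ℤ m →
                        + 4 *ℤ (+ 10 *ℤ N -ℤ + 3 *ℤ m) ≤ℤ m *ℤ ((+ 2 *ℤ b -ℤ + 3) *ℤ (+ 2 *ℤ b -ℤ + 3)) →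
                        + 5 *ℤ a <ℤ b *ℤ b +ℤ + 2 *ℤ b +ℤ + 6
  lowerEnd⇒5a<b²+2b+6 0≤b 0<m lower =
    *-cancelˡ-<-nonNeg (+ 4 *ℤ m) ⦃ nonNegative (*-monoˡ-≤-nonNeg (+ 4) (<⇒≤ 0<m)) ⦄ (begin-strict
      + 4 *ℤ m *ℤ (+ 5 *ℤ a)                                    <⟨ i<i+j _ slack-pos ⟩
      + 4 *ℤ m *ℤ (+ 5 *ℤ a) +ℤ (+ 3 *ℤ m +ℤ + 40 *ℤ b)          ≡⟨ solve (a ∷ b ∷ m ∷ []) ⟩
      + 4 *ℤ (+ 5 *ℤ (m *ℤ (a -ℤ b) +ℤ + 2 *ℤ b) -ℤ + 3 *ℤ m) +ℤ + 5 *ℤ m *ℤ (+ 4 *ℤ b +ℤ + 3)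
                                                                ≡⟨ cong (λ x → + 4 *ℤ (+ 5 *ℤ x -ℤ + 3 *ℤ m) +ℤ + 5 *ℤ m *ℤ (+ 4 *ℤ b +ℤ + 3)) (sym 2N≡) ⟩
      + 4 *ℤ (+ 5 *ℤ (+ 2 *ℤ N) -ℤ + 3 *ℤ m) +ℤ + 5 *ℤ m *ℤ (+ 4 *ℤ b +ℤ + 3)
                                                                ≡⟨ solve (b ∷ m ∷ N ∷ []) ⟩
      + 4 *ℤ (+ 10 *ℤ N -ℤ + 3 *ℤ m) +ℤ + 5 *ℤ m *ℤ (+ 4 *ℤ b +ℤ + 3)
                                                                ≤⟨ +-monoˡ-≤ _ lower ⟩
      m *ℤ ((+ 2 *ℤ b -ℤ + 3) *ℤ (+ 2 *ℤ b -ℤ + 3)) +ℤ + 5 *ℤ m *ℤ (+ 4 *ℤ b +ℤ + 3)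
                                                                ≡⟨ solve (b ∷ m ∷ []) ⟩
      + 4 *ℤ m *ℤ (b *ℤ b +ℤ + 2 *ℤ b +ℤ + 6)                   ∎)
    where
    open ≤-Reasoning
    slack-pos : 0ℤ <ℤ + 3 *ℤ m +ℤ + 40 *ℤ b
    slack-pos = +-mono-<-≤ (*-monoˡ-<-pos (+ 3) 0<m) (*-monoˡ-≤-nonNeg (+ 40) 0≤b)

lemma3p2 : (a b m N : ℕ) → 1 ≤ a → 1 ≤ b → 3 ≤ m → 1 ≤ N
    → + 2 *ℤ + N ≡ + m *ℤ (+ a -ℤ + b) +ℤ + 2 *ℤ + b
    → 3 * m ≤ 5 * N
    → LowerEnd m N b → UpperEnd m N b
    → (b * b < 6 * a) × (5 * a < b * b + 2 * b + 6)
lemma3p2 a b m N _ _ 3≤m _ 2N≡ _ (_ , lower) upper =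
    drop‿+<+ (subst₂ _<ℤ_ (sym (pos-* b b)) (sym (pos-* 6 a)) b²<6a)
  , drop‿+<+ (subst₂ _<ℤ_ (sym (pos-* 5 a))
                          (sym (cong₂ (λ x y → x +ℤ y +ℤ + 6) (pos-* b b) (pos-* 2 b))) 5a<b²+2b+6)
  where
  0≤b : 0ℤ ≤ℤ + b
  0≤b = +≤+ z≤n
  b²<6a : + b *ℤ + b <ℤ + 6 *ℤ + a
  b²<6a = upperEnd⇒b²<6a {N = + N} 2N≡ 0≤b (+≤+ 3≤m) upper
  5a<b²+2b+6 : + 5 *ℤ + a <ℤ + b *ℤ + b +ℤ + 2 *ℤ + b +ℤ + 6
  5a<b²+2b+6 = lowerEnd⇒5a<b²+2b+6 {N = + N} 2N≡ 0≤b (<-≤-trans (+<+ (s≤s z≤n)) (+≤+ 3≤m)) lower
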